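{- Let $G=(V,E)$ be a finite simple undirected graph, $k$ a positive integer, $S\subseteq V$ a $k$-plex of $G$, and $C\subseteq V\setminus S$. Let $I=\{v_1,v_2,\dots,v_{|I|}\}\subseteq C$ be an independent set of $G$ whose vertices are indexed so that $\delta_k^{ - }(S,v_1)\ge \delta_k^{ - }(S,v_2)\ge\cdots\ge \delta_k^{ - }(S,v_{|I|})$. Then for every $T\subseteq I$ such that $S\cup T$ is a $k$-plex of $G$, we have $|T|\le \max\{\, i\in\{1,\dots,|I|\} : \delta_k^{ - }(S,v_i)\ge i\,\}$. In other words, $\max\{ i : \delta_k^{ - }(S,v_i)\ge i\}$ is an upper bound on the number of vertices that $I$ can provide for $S$.
   Context: For $v\in V$, $N(v)$ denotes the set of vertices adjacent to $v$ (so $v\notin N(v)$). A set $S\subseteq V$ is a $k$-plex if every $v\in S$ satisfies $|S\setminus N(v)|\le k$ (i.e. $v$ is non-adjacent to at most $k$ vertices of $S$, counting $v$ itself). For $v\in V$, $\delta(S,v)=|S\setminus N(v)|$ and $\delta_k^{ - }(S,v)=k-\delta(S,v)$. An independent set is a set of pairwise non-adjacent vertices. The "number of vertices that a set $I\subseteq C$ can provide for $S$" means $\max\{|T| : T\subseteq I,\ S\cup T \text{ is a } k\text{ -plex}\}$; an upper bound on it is any number $\ge$ this maximum. The maximum of the empty set is taken to be $0$. -}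

module Defs where

open import Data.Nat using (ℕ; zero; suc; _≤_; _⊔_)
open import Data.Integer as ℤ using (ℤ; +_; _-_)
open import Data.Bool using (Bool; true; false; if_then_else_)
open import Data.Fin using (Fin; toℕ)
open import Data.Fin.Subset using (Subset; _∈_; _∩_; ∁; ∣_∣)
open import Data.List using (List; map; foldr; allFin)
open import Data.Vec using (tabulate)
open import Relation.Nullary.Decidable using (⌊_⌋)
open import Relation.Binary.PropositionalEquality using (_≡_)

record Graph (n : ℕ) : Set where
  field
    adj     : Fin n → Fin n → Bool
    sym     : ∀ u v → adj u v ≡ adj v u
    irrefl  : ∀ v → adj v v ≡ false

open Graph public

module _ {n : ℕ} (G : Graph n) where

  N : Fin n → Subset n
  N v = tabulate (λ u → adj G v u)

  δ : Subset n → Fin n → ℕ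
  δ S v = ∣ S ∩ ∁ (N v) ∣

  δ⁻ : ℕ → Subset n → Fin n → ℤ
  δ⁻ k S v = + k - + δ S v

  IsKPlex : ℕ → Subset n → Set
  IsKPlex k S = ∀ v → v ∈ S → δ S v ≤ k

-- max { i ∈ {1,…,m} : f(v_i) ≥ i } with 1-based index i = toℕ j + 1,
-- and max ∅ = 0.
maxIdx : ∀ {m} → (Fin m → ℤ) → ℕ
maxIdx {m} f =
  foldr _⊔_ 0
    (map (λ j → if ⌊ (+ suc (toℕ j)) ℤ.≤? f j ⌋ then suc (toℕ j) else 0)
         (allFin m))

-- Every member u of T is non-adjacent to all of T (T is independent) and T is disjoint from S,
-- so δ(S ∪ T, u) ≥ |T| + δ(S, u); as S ∪ T is a k-plex this gives δ⁻(S, u) ≥ |T|.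
-- If |T| = t, the t members of T cannot all have index < t, so some v_i ∈ T has i ≥ t, and by
-- monotonicity δ⁻(S, v_t) ≥ δ⁻(S, v_i) ≥ t: the index t is among those the maximum ranges over.
module Submission where

open import Defs
open import Data.Nat using (ℕ; suc; _≤_; _<_)
open import Data.Integer as ℤ using (ℤ)
open import Data.Bool using (false)
open import Data.Fin using (Fin; _≤_)
open import Data.Fin.Subset using (Subset; _∈_; _∉_; _⊆_; _∪_; ∣_∣)
open import Data.Product using (∃)
open import Function.Definitions using (Injective)
open import Relation.Binary.PropositionalEquality using (_≡_)

open import Data.Bool using (true; if_then_else_)
open import Data.Empty using (⊥-elim)
open import Data.Fin as Fin using (zero; suc; toℕ; fromℕ<)
import Data.Fin.Properties as Finₚ
open import Data.Fin.Subset using (⊥; ⁅_⁆; _∩_; ∁; inside; outside)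
open import Data.Fin.Subset.Properties
import Data.Integer.Properties as ℤₚ
open import Data.List using (List; _∷_; foldr)
open import Data.List.Membership.Propositional using () renaming (_∈_ to _∈ₗ_)
open import Data.List.Membership.Propositional.Properties using (∈-map⁺; ∈-allFin)
open import Data.List.Relation.Unary.Any using (here; there)
open import Data.Nat as ℕ using (zero; _+_; _∸_; _⊔_; z≤n; s≤s)
import Data.Nat.Properties as ℕₚ
open import Data.Product using (_,_; _×_)
open import Data.Sum using (inj₁; inj₂)
open import Data.Vec using ([]; _∷_; tabulate)
open import Data.Vec.Properties using (lookup∘tabulate; []=⇒lookup)
open import Function using (_∘_)
open import Relation.Nullary using (yes; no; contradiction)
open import Relation.Nullary.Decidable using (⌊_⌋; _×-dec_)
open import Relation.Binary.PropositionalEquality using (refl; trans; cong; subst; module ≡-Reasoning)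
  renaming (sym to ≡-sym)

∣p∪q∣+∣p∩q∣≡∣p∣+∣q∣ : ∀ {n} (p q : Subset n) → ∣ p ∪ q ∣ + ∣ p ∩ q ∣ ≡ ∣ p ∣ + ∣ q ∣
∣p∪q∣+∣p∩q∣≡∣p∣+∣q∣ []            []            = refl
∣p∪q∣+∣p∩q∣≡∣p∣+∣q∣ (outside ∷ p) (outside ∷ q) = ∣p∪q∣+∣p∩q∣≡∣p∣+∣q∣ p q
∣p∪q∣+∣p∩q∣≡∣p∣+∣q∣ (outside ∷ p) (inside  ∷ q) =
  trans (cong suc (∣p∪q∣+∣p∩q∣≡∣p∣+∣q∣ p q)) (≡-sym (ℕₚ.+-suc ∣ p ∣ ∣ q ∣))
∣p∪q∣+∣p∩q∣≡∣p∣+∣q∣ (inside  ∷ p) (outside ∷ q) = cong suc (∣p∪q∣+∣p∩q∣≡∣p∣+∣q∣ p q)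
∣p∪q∣+∣p∩q∣≡∣p∣+∣q∣ (inside  ∷ p) (inside  ∷ q) = cong suc (begin
  ∣ p ∪ q ∣ + suc ∣ p ∩ q ∣  ≡⟨ ℕₚ.+-suc ∣ p ∪ q ∣ ∣ p ∩ q ∣ ⟩
  suc (∣ p ∪ q ∣ + ∣ p ∩ q ∣) ≡⟨ cong suc (∣p∪q∣+∣p∩q∣≡∣p∣+∣q∣ p q) ⟩
  suc (∣ p ∣ + ∣ q ∣)         ≡⟨ ℕₚ.+-suc ∣ p ∣ ∣ q ∣ ⟨
  ∣ p ∣ + suc ∣ q ∣           ∎)
  where open ≡-Reasoning

∣p∪q∣≤∣p∣+∣q∣ : ∀ {n} (p q : Subset n) → ∣ p ∪ q ∣ ℕ.≤ ∣ p ∣ + ∣ q ∣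
∣p∪q∣≤∣p∣+∣q∣ p q = subst (∣ p ∪ q ∣ ℕ.≤_) (∣p∪q∣+∣p∩q∣≡∣p∣+∣q∣ p q) (ℕₚ.m≤m+n _ _)

∣p∪q∣≡∣p∣+∣q∣ : ∀ {n} (p q : Subset n) → (∀ {x} → x ∈ p → x ∉ q) → ∣ p ∪ q ∣ ≡ ∣ p ∣ + ∣ q ∣
∣p∪q∣≡∣p∣+∣q∣ {n} p q disjoint = begin
  ∣ p ∪ q ∣                ≡⟨ ℕₚ.+-identityʳ ∣ p ∪ q ∣ ⟨
  ∣ p ∪ q ∣ + 0            ≡⟨ cong (∣ p ∪ q ∣ +_) ∣p∩q∣≡0 ⟨
  ∣ p ∪ q ∣ + ∣ p ∩ q ∣    ≡⟨ ∣p∪q∣+∣p∩q∣≡∣p∣+∣q∣ p q ⟩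
  ∣ p ∣ + ∣ q ∣            ∎
  where
  open ≡-Reasoning
  p∩q⊆⊥ : p ∩ q ⊆ ⊥
  p∩q⊆⊥ x∈p∩q with x∈p∩q⁻ p q x∈p∩q
  ... | x∈p , x∈q = ⊥-elim (disjoint x∈p x∈q)
  ∣p∩q∣≡0 : ∣ p ∩ q ∣ ≡ 0
  ∣p∩q∣≡0 = ℕₚ.n≤0⇒n≡0 (subst (∣ p ∩ q ∣ ℕ.≤_) (∣⊥∣≡0 n) (p⊆q⇒∣p∣≤∣q∣ p∩q⊆⊥))

imageBelow : ∀ {m n} → (Fin m → Fin n) → ℕ → Subset n
imageBelow {zero}  g p       = ⊥
imageBelow {suc m} g zero    = ⊥
imageBelow {suc m} g (suc p) = ⁅ g zero ⁆ ∪ imageBelow (g ∘ suc) p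

∣imageBelow∣≤ : ∀ {m n} (g : Fin m → Fin n) p → ∣ imageBelow g p ∣ ℕ.≤ p
∣imageBelow∣≤ {zero}  {n} g p       = subst (ℕ._≤ p) (≡-sym (∣⊥∣≡0 n)) z≤n
∣imageBelow∣≤ {suc m} {n} g zero    = ℕₚ.≤-reflexive (∣⊥∣≡0 n)
∣imageBelow∣≤ {suc m}     g (suc p) = begin
  ∣ ⁅ g zero ⁆ ∪ imageBelow (g ∘ suc) p ∣     ≤⟨ ∣p∪q∣≤∣p∣+∣q∣ ⁅ g zero ⁆ _ ⟩
  ∣ ⁅ g zero ⁆ ∣ + ∣ imageBelow (g ∘ suc) p ∣ ≡⟨ cong (_+ ∣ imageBelow (g ∘ suc) p ∣) (∣⁅x⁆∣≡1 (g zero)) ⟩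
  suc ∣ imageBelow (g ∘ suc) p ∣              ≤⟨ s≤s (∣imageBelow∣≤ (g ∘ suc) p) ⟩
  suc p                                       ∎
  where open ℕₚ.≤-Reasoning

∈imageBelow : ∀ {m n} (g : Fin m → Fin n) {p} i → toℕ i ℕ.< p → g i ∈ imageBelow g p
∈imageBelow g {suc p} zero    _          = x∈p∪q⁺ (inj₁ (x∈⁅x⁆ (g zero)))
∈imageBelow g {suc p} (suc i) (s≤s i<p) = x∈p∪q⁺ (inj₂ (∈imageBelow (g ∘ suc) i i<p))

-- A pigeonhole step: the members of T with index < p lie in imageBelow v p, which has at most p elements.
∃-member-with-index≥ : ∀ {m n} (v : Fin m → Fin n) (T : Subset n) {p} →
  (∀ x → x ∈ T → ∃ λ i → v i ≡ x) → suc p ℕ.≤ ∣ T ∣ → ∃ λ i → v i ∈ T × p ℕ.≤ toℕ i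
∃-member-with-index≥ v T {p} T⊆v p<∣T∣
  with Finₚ.any? (λ i → (v i ∈? T) ×-dec (p ℕₚ.≤? toℕ i))
... | yes found = found
... | no none = ⊥-elim (ℕₚ.n≮n p (ℕₚ.≤-trans p<∣T∣ (ℕₚ.≤-trans (p⊆q⇒∣p∣≤∣q∣ T⊆image) (∣imageBelow∣≤ v p))))
  where
  T⊆image : T ⊆ imageBelow v p
  T⊆image {x} x∈T with T⊆v x x∈T
  ... | i , refl with p ℕₚ.≤? toℕ i
  ...   | yes p≤i = ⊥-elim (none (i , x∈T , p≤i))
  ...   | no  p≰i = ∈imageBelow v i (ℕₚ.≰⇒> p≰i)

∈⇒≤foldr-⊔ : ∀ {x} {xs : List ℕ} → x ∈ₗ xs → x ℕ.≤ foldr _⊔_ 0 xs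
∈⇒≤foldr-⊔ {xs = y ∷ ys} (here refl) = ℕₚ.m≤m⊔n y (foldr _⊔_ 0 ys)
∈⇒≤foldr-⊔ {xs = y ∷ ys} (there x∈ys) = ℕₚ.≤-trans (∈⇒≤foldr-⊔ x∈ys) (ℕₚ.m≤n⊔m y _)

maxIdx-≥ : ∀ {m} (f : Fin m → ℤ) j → ℤ.+ suc (toℕ j) ℤ.≤ f j → suc (toℕ j) ℕ.≤ maxIdx f
maxIdx-≥ {m} f j j+1≤fj = ℕₚ.≤-trans entry≥ (∈⇒≤foldr-⊔ (∈-map⁺ entry (∈-allFin j)))
  where
  entry : Fin m → ℕ
  entry i = if ⌊ ℤ.+ suc (toℕ i) ℤ.≤? f i ⌋ then suc (toℕ i) else 0
  entry≥ : suc (toℕ j) ℕ.≤ entry j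
  entry≥ with ℤ.+ suc (toℕ j) ℤ.≤? f j
  ... | yes _        = ℕₚ.≤-refl
  ... | no  j+1≰fj = ⊥-elim (j+1≰fj j+1≤fj)

maxIdx-≥-antitone : ∀ {m} (f : Fin m → ℤ) → (∀ {i j} → i Fin.≤ j → f j ℤ.≤ f i) →
  ∀ i {p} → p ℕ.≤ toℕ i → ℤ.+ suc p ℤ.≤ f i → suc p ℕ.≤ maxIdx f
maxIdx-≥-antitone f antitone i {p} p≤i p+1≤fi =
  subst (λ q → suc q ℕ.≤ maxIdx f) toℕj≡p (maxIdx-≥ f j j+1≤fj)
  where
  p<m = ℕₚ.≤-<-trans p≤i (Finₚ.toℕ<n i)
  j = fromℕ< p<m
  toℕj≡p : toℕ j ≡ p
  toℕj≡p = Finₚ.toℕ-fromℕ< p<m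
  j+1≤fj : ℤ.+ suc (toℕ j) ℤ.≤ f j
  j+1≤fj = subst (λ q → ℤ.+ suc q ℤ.≤ f j) (≡-sym toℕj≡p)
             (ℤₚ.≤-trans p+1≤fi (antitone (subst (ℕ._≤ toℕ i) (≡-sym toℕj≡p) p≤i)))

∣T∣≤maxIdx : ∀ {m n} (v : Fin m → Fin n) (f : Fin m → ℤ) → (∀ {i j} → i Fin.≤ j → f j ℤ.≤ f i) →
  (T : Subset n) → (∀ x → x ∈ T → ∃ λ i → v i ≡ x) →
  (∀ i → v i ∈ T → ℤ.+ ∣ T ∣ ℤ.≤ f i) → ∣ T ∣ ℕ.≤ maxIdx f
∣T∣≤maxIdx v f antitone T T⊆v ∣T∣≤f with ∣ T ∣ in ∣T∣≡
... | zero  = z≤n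
... | suc p with ∃-member-with-index≥ v T T⊆v (ℕₚ.≤-reflexive (≡-sym ∣T∣≡))
... | i , vi∈T , p≤i =
  maxIdx-≥-antitone f antitone i p≤i (∣T∣≤f i vi∈T)

+a≤+b-+c : ∀ {a b c} → a + c ℕ.≤ b → ℤ.+ a ℤ.≤ ℤ.+ b ℤ.- ℤ.+ c
+a≤+b-+c {a} {b} {c} a+c≤b = subst (ℤ.+ a ℤ.≤_) (≡-sym b-c≡b∸c) (ℤ.+≤+ (ℕₚ.m+n≤o⇒m≤o∸n a a+c≤b))
  where
  b-c≡b∸c : ℤ.+ b ℤ.- ℤ.+ c ≡ ℤ.+ (b ∸ c)
  b-c≡b∸c = trans (ℤₚ.[+m]-[+n]≡m⊖n b c) (ℤₚ.⊖-≥ (ℕₚ.m+n≤o⇒n≤o a a+c≤b))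

module _ {n} (G : Graph n) where

  ∈N⇒adj : ∀ {u x} → x ∈ N G u → adj G u x ≡ true
  ∈N⇒adj {u} {x} x∈Nu = trans (≡-sym (lookup∘tabulate (adj G u) x)) ([]=⇒lookup x∈Nu)

  ∣T∣+δ≤δ[S∪T] : ∀ S T u → (∀ {x} → x ∈ T → x ∉ S) → (∀ {x} → x ∈ T → adj G u x ≡ false) →
    ∣ T ∣ + δ G S u ℕ.≤ δ G (S ∪ T) u
  ∣T∣+δ≤δ[S∪T] S T u T∩S=∅ T-non-adjacent = begin
    ∣ T ∣ + ∣ S ∩ ∁ (N G u) ∣      ≡⟨ ∣p∪q∣≡∣p∣+∣q∣ T _ (λ x∈T x∈S∩ → T∩S=∅ x∈T (proj-S x∈S∩)) ⟨
    ∣ T ∪ (S ∩ ∁ (N G u)) ∣        ≤⟨ p⊆q⇒∣p∣≤∣q∣ ⊆[S∪T]∖N ⟩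
    ∣ (S ∪ T) ∩ ∁ (N G u) ∣        ∎
    where
    open ℕₚ.≤-Reasoning
    proj-S : ∀ {x} → x ∈ S ∩ ∁ (N G u) → x ∈ S
    proj-S x∈S∩ with x∈p∩q⁻ S _ x∈S∩
    ... | x∈S , _ = x∈S
    T∖N : ∀ {x} → x ∈ T → x ∈ ∁ (N G u)
    T∖N x∈T = x∉p⇒x∈∁p λ x∈N → contradiction (trans (≡-sym (∈N⇒adj x∈N)) (T-non-adjacent x∈T)) λ ()
    ⊆[S∪T]∖N : T ∪ (S ∩ ∁ (N G u)) ⊆ (S ∪ T) ∩ ∁ (N G u)
    ⊆[S∪T]∖N {x} x∈ with x∈p∪q⁻ T _ x∈
    ... | inj₁ x∈T = x∈p∩q⁺ (x∈p∪q⁺ (inj₂ x∈T) , T∖N x∈T)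
    ... | inj₂ x∈S∩ with x∈p∩q⁻ S _ x∈S∩
    ...   | x∈S , x∉N = x∈p∩q⁺ (x∈p∪q⁺ (inj₁ x∈S) , x∉N)

  ∣T∣≤δ⁻ : ∀ k S T u → IsKPlex G k (S ∪ T) → u ∈ T →
    (∀ {x} → x ∈ T → x ∉ S) → (∀ {x} → x ∈ T → adj G u x ≡ false) → ℤ.+ ∣ T ∣ ℤ.≤ δ⁻ G k S u
  ∣T∣≤δ⁻ k S T u S∪T-plex u∈T T∩S=∅ T-non-adjacent =
    +a≤+b-+c (ℕₚ.≤-trans (∣T∣+δ≤δ[S∪T] S T u T∩S=∅ T-non-adjacent) (S∪T-plex u (x∈p∪q⁺ (inj₂ u∈T))))

lemma1 : ∀ {n : ℕ} (G : Graph n) (k : ℕ) → 0 < k →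
    (S C : Subset n) → IsKPlex G k S →
    (∀ u → u ∈ C → u ∉ S) →
    (m : ℕ) (v : Fin m → Fin n) → Injective _≡_ _≡_ v →
    (∀ i → v i ∈ C) →
    (∀ i j → adj G (v i) (v j) ≡ false) →
    (∀ i j → i Data.Fin.≤ j → δ⁻ G k S (v j) ℤ.≤ δ⁻ G k S (v i)) →
    (T : Subset n) → (∀ u → u ∈ T → ∃ (λ i → v i ≡ u)) →
    IsKPlex G k (S ∪ T) →
    ∣ T ∣ Data.Nat.≤ maxIdx (λ i → δ⁻ G k S (v i))
lemma1 G k _ S C _ C∩S=∅ m v _ v∈C independent antitone T T⊆v S∪T-plex =
  ∣T∣≤maxIdx v (δ⁻ G k S ∘ v) (antitone _ _) T T⊆v
    (λ i vi∈T → ∣T∣≤δ⁻ G k S T (v i) S∪T-plex vi∈T T∩S=∅ (non-adjacent i))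
  where
  T∩S=∅ : ∀ {x} → x ∈ T → x ∉ S
  T∩S=∅ {x} x∈T with T⊆v x x∈T
  ... | j , refl = C∩S=∅ (v j) (v∈C j)
  non-adjacent : ∀ i {x} → x ∈ T → adj G (v i) x ≡ false
  non-adjacent i {x} x∈T with T⊆v x x∈T
  ... | j , refl = independent i j
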